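{- Let $G_1,\dots,G_n$ be finite groups such that for all $i\neq j$, $\mathcal{J}(G_i)\cap\mathcal{J}(G_j)=\emptyset$ and $\gcd(|G_i^{\mathrm{ab}}|,|G_j^{\mathrm{ab}}|)=1$. Let $H$ be a subgroup of $G_1\times\cdots\times G_n$ such that $\mathrm{pr}_i(H)=G_i$ for every projection $\mathrm{pr}_i:G_1\times\cdots\times G_n\to G_i$. Then $H=G_1\times\cdots\times G_n$.
   Context: For a finite group $G$, $\mathcal{J}(G)$ is the set of isomorphism classes of non-abelian simple groups occurring in some (equivalently, any) composition series of $G$; $G^{\mathrm{ab}}=G/G'$ is the abelianization. -}

module Defs where

open import Data.Nat using (ℕ; suc)
open import Data.Nat.Coprimality using (Coprime)
open import Data.Fin using (Fin; zero; suc; inject₁; fromℕ)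
open import Data.Bool using (Bool; true; false)
open import Data.Product using (Σ; ∃; ∃-syntax; _×_; _,_)
open import Data.Sum using (_⊎_)
open import Data.List using (List; []; _∷_)
open import Relation.Binary.PropositionalEquality using (_≡_; _≢_)
open import Relation.Nullary using (¬_)
open import Algebra.Structures using (IsGroup)

-- A finite group, presented (up to isomorphism) on the carrier Fin order,
-- with propositional equality.
record FinGroup : Set where
  field
    order   : ℕ
    _·_     : Fin order → Fin order → Fin order
    e       : Fin order
    inv     : Fin order → Fin order
    isGroup : IsGroup _≡_ _·_ e inv

module _ (G : FinGroup) where
  open FinGroup G

  Elt : Set
  Elt = Fin order

  SubsetG : Set
  SubsetG = Elt → Bool

  _∈_ : Elt → SubsetG → Set
  x ∈ A = A x ≡ true

  _⊆_ : SubsetG → SubsetG → Set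
  A ⊆ B = ∀ x → x ∈ A → x ∈ B

  IsSubgroup : SubsetG → Set
  IsSubgroup A = (e ∈ A)
               × (∀ x y → x ∈ A → y ∈ A → (x · y) ∈ A)
               × (∀ x → x ∈ A → inv x ∈ A)

  IsNormalIn : SubsetG → SubsetG → Set
  IsNormalIn B A = ∀ g x → g ∈ A → x ∈ B → ((g · x) · inv g) ∈ B

  IsNormalSubgroup : SubsetG → Set
  IsNormalSubgroup N = IsSubgroup N × (∀ g x → x ∈ N → ((g · x) · inv g) ∈ N)

  -- A composition series G = N 0 ⊳ N 1 ⊳ ... ⊳ N k = 1 : each N (j+1) is a
  -- proper normal subgroup of N j, maximal among normal subgroups of N j
  -- (i.e. N j / N (j+1) is simple).
  record CompositionSeries : Set where
    field
      len      : ℕ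
      N        : Fin (suc len) → SubsetG
      subgrp   : ∀ j → IsSubgroup (N j)
      top      : ∀ x → x ∈ N zero
      bottom   : ∀ x → x ∈ N (fromℕ len) → x ≡ e
      sub      : ∀ (j : Fin len) → N (suc j) ⊆ N (inject₁ j)
      normal   : ∀ (j : Fin len) → IsNormalIn (N (suc j)) (N (inject₁ j))
      proper   : ∀ (j : Fin len) → ∃[ x ] (x ∈ N (inject₁ j) × ¬ (x ∈ N (suc j)))
      maximal  : ∀ (j : Fin len) (M : SubsetG) → IsSubgroup M
               → N (suc j) ⊆ M → M ⊆ N (inject₁ j) → IsNormalIn M (N (inject₁ j))
               → (M ⊆ N (suc j)) ⊎ (N (inject₁ j) ⊆ M)

  -- A / B ≅ S (for B ⊆ A subgroups): a homomorphism from A onto S with kernel B.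
  QuotientIso : SubsetG → SubsetG → FinGroup → Set
  QuotientIso A B S =
    Σ (Elt → Fin (FinGroup.order S)) λ φ → ( (∀ x y → x ∈ A → y ∈ A → φ (x · y) ≡ FinGroup._·_ S (φ x) (φ y))
           × (∀ s → Σ Elt λ x → (x ∈ A × φ x ≡ s))
           × (∀ x → x ∈ A → (φ x ≡ FinGroup.e S → x ∈ B) × (x ∈ B → φ x ≡ FinGroup.e S)) )

  -- S (up to isomorphism) occurs as a composition factor of G, i.e. [S] ∈ 𝒥(G)
  -- when S is non-abelian simple.
  OccursAsFactor : FinGroup → Set
  OccursAsFactor S = Σ CompositionSeries λ cs →
    let open CompositionSeries cs in
    ∃[ j ] QuotientIso (N (inject₁ j)) (N (suc j)) S

  commutator : Elt → Elt → Elt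
  commutator x y = ((inv x · inv y) · x) · y

  data ProdOfComms : Elt → Set where
    nil  : ProdOfComms e
    cons : ∀ x y {z} → ProdOfComms z → ProdOfComms (commutator x y · z)

  -- |G^ab| = a : there are exactly a cosets of G' in G
  -- (a transversal indexed by Fin a).
  AbelianizationOrder : ℕ → Set
  AbelianizationOrder a =
    Σ (Fin a → Elt) λ r → ( (∀ (i j : Fin a) → ProdOfComms (inv (r i) · r j) → i ≡ j)
           × (∀ x → ∃[ i ] ProdOfComms (inv (r i) · x)) )

NonAbelianSimple : FinGroup → Set
NonAbelianSimple S =
  (∃[ x ] ∃[ y ] (x · y ≢ y · x))
  × (∀ N → IsNormalSubgroup S N → (∀ x → _∈_ S x N → x ≡ e) ⊎ (∀ x → _∈_ S x N))
  where open FinGroup S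

Prod : {n : ℕ} → (Fin n → FinGroup) → Set
Prod {n} G = (i : Fin n) → Fin (FinGroup.order (G i))

IsSubgroupOfProd : {n : ℕ} (G : Fin n → FinGroup) → (Prod G → Bool) → Set
IsSubgroupOfProd G H =
    (∀ x y → (∀ i → x i ≡ y i) → H x ≡ true → H y ≡ true)
  × (H (λ i → FinGroup.e (G i)) ≡ true)
  × (∀ x y → H x ≡ true → H y ≡ true → H (λ i → FinGroup._·_ (G i) (x i) (y i)) ≡ true)
  × (∀ x → H x ≡ true → H (λ i → FinGroup.inv (G i) (x i)) ≡ true)

-- Induction on the number of factors. The projection H₊ of H to G₁ × ⋯ × Gₙ₋₁ is again
-- subdirect, hence everything, so every tail y occurs in some (g , y) ∈ H. The set K of
-- g with (g , 1) ∈ H is normal in G₀, and H is everything as soon as K = G₀. Otherwise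
-- choose a maximal normal subgroup B ⊇ K of G₀: then y ↦ gB is a well-defined surjection
-- from G₁ × ⋯ × Gₙ₋₁ onto the simple group S = G₀/B, and a surjection from a direct product
-- onto a simple group is already surjective on one factor Gⱼ. If S is non-abelian it is a
-- composition factor of both G₀ and Gⱼ; if it is abelian, |S| > 1 divides the orders of both
-- abelianizations.
--
-- All objects are finite, so subgroups, maximal normal subgroups, composition series,
-- quotient groups and transversals of the derived subgroup are found by exhaustive search.

module Submission where

open import Defs
open import Level using (0ℓ)
open import Algebra.Bundles using (Group)
open import Algebra.Structures using (IsGroup)
import Algebra.Properties.Group as GroupProperties
open import Data.Bool using (Bool; true; _∨_)
import Data.Bool.Properties as Bool
open import Data.Empty using (⊥; ⊥-elim)
open import Data.Fin using (Fin; zero; suc; inject₁; fromℕ; combine; remQuot)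
open import Data.Fin.Properties using (_≟_; any?; all?; ¬∀⟶∃¬; suc-injective; remQuot-combine; combine-remQuot)
import Data.Fin.Subset as Subset
open import Data.Fin.Subset.Properties using (anySubset?)
open import Data.Fin.Subset.Induction using (⊂-wellFounded; ⊃-wellFounded)
open import Data.List using (List; filter; allFin; length)
import Data.List as List
open import Data.List.Membership.Propositional using () renaming (_∈_ to _∈ₗ_)
open import Data.List.Membership.Propositional.Properties using (∈-lookup; ∈-filter⁺; ∈-filter⁻; ∈-allFin)
import Data.List.Relation.Unary.All as All
open import Data.List.Relation.Unary.AllPairs using (_∷_)
open import Data.List.Relation.Unary.Any using (index)
open import Data.List.Relation.Unary.Any.Properties using (lookup-index)
open import Data.List.Relation.Unary.Unique.Propositional using (Unique)
import Data.List.Relation.Unary.Unique.Propositional.Properties as Unique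
open import Data.Nat using (ℕ; zero; suc; _*_)
open import Data.Nat.Coprimality using (Coprime)
open import Data.Nat.Divisibility using (m∣m*n)
open import Data.Product using (∃; ∃-syntax; _×_; _,_; proj₁; proj₂; uncurry)
open import Data.Sum using (_⊎_; inj₁; inj₂)
open import Data.Vec using (tabulate; lookup)
open import Data.Vec.Properties using (lookup∘tabulate; lookup⇒[]=; []=⇒lookup)
open import Function using (_∘_; flip; id; _⇔_; mk⇔; Equivalence)
open import Induction.WellFounded using (WellFounded; Acc; acc; module Subrelation)
open import Relation.Binary using (Rel; IsDecEquivalence)
import Relation.Binary.Construct.On as On
open import Relation.Binary.PropositionalEquality
  using (_≡_; _≢_; refl; sym; trans; cong; cong₂; subst; isEquivalence; module ≡-Reasoning)
open import Relation.Nullary using (¬_; Dec; yes; no; does; map′; _×-dec_; _→-dec_; ¬?)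
open import Relation.Nullary.Decidable using (dec-true)
open import Relation.Unary using (Decidable)

-- Decidable subsets of Fin n

from-does : ∀ {P : Set} (d : Dec P) → does d ≡ true → P
from-does (yes p) _ = p

module _ {n : ℕ} where

  _⊆ᵇ_ : (Fin n → Bool) → (Fin n → Bool) → Set
  A ⊆ᵇ B = ∀ x → A x ≡ true → B x ≡ true

  _⊊_ : (Fin n → Bool) → (Fin n → Bool) → Set
  A ⊊ B = A ⊆ᵇ B × ∃[ x ] (B x ≡ true × ¬ A x ≡ true)

  _⊆ᵇ?_ : ∀ A B → Dec (A ⊆ᵇ B)
  A ⊆ᵇ? B = all? λ x → (A x Bool.≟ true) →-dec (B x Bool.≟ true)

  _⊊?_ : ∀ A B → Dec (A ⊊ B)
  A ⊊? B = A ⊆ᵇ? B ×-dec any? λ x → (B x Bool.≟ true) ×-dec ¬? (A x Bool.≟ true)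

  ≗⇒⊆ : ∀ {A B} → (∀ x → A x ≡ B x) → A ⊆ᵇ B
  ≗⇒⊆ A≗B x = trans (sym (A≗B x))

  ⊊-respʳ : ∀ {A B B′} → (∀ x → B x ≡ B′ x) → A ⊊ B → A ⊊ B′
  ⊊-respʳ B≗B′ (A⊆B , x , x∈B , x∉A) = (λ y → ≗⇒⊆ B≗B′ y ∘ A⊆B y) , x , ≗⇒⊆ B≗B′ x x∈B , x∉A

  ⊈⇒∃ : ∀ {A B} → ¬ A ⊆ᵇ B → ∃[ x ] (A x ≡ true × ¬ B x ≡ true)
  ⊈⇒∃ {A} {B} A⊈B with ¬∀⟶∃¬ n _ (λ x → (A x Bool.≟ true) →-dec (B x Bool.≟ true)) A⊈B
  ... | x , ¬A⇒B with A x Bool.≟ true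
  ...   | yes x∈A = x , x∈A , λ x∈B → ¬A⇒B (λ _ → x∈B)
  ...   | no x∉A = ⊥-elim (¬A⇒B (⊥-elim ∘ x∉A))

  private
    ∈-tabulate⁺ : ∀ {A : Fin n → Bool} {x} → A x ≡ true → x Subset.∈ tabulate A
    ∈-tabulate⁺ {A} {x} p = lookup⇒[]= x (tabulate A) (trans (lookup∘tabulate A x) p)

    ∈-tabulate⁻ : ∀ {A : Fin n → Bool} {x} → x Subset.∈ tabulate A → A x ≡ true
    ∈-tabulate⁻ {A} {x} p = trans (sym (lookup∘tabulate A x)) ([]=⇒lookup p)

    ⊊⇒⊂ : ∀ {A B} → A ⊊ B → tabulate A Subset.⊂ tabulate B
    ⊊⇒⊂ (A⊆B , x , x∈B , x∉A) =
      (λ p → ∈-tabulate⁺ (A⊆B _ (∈-tabulate⁻ p))) , x , ∈-tabulate⁺ x∈B , x∉A ∘ ∈-tabulate⁻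

  ⊊-wellFounded : WellFounded _⊊_
  ⊊-wellFounded = Subrelation.wellFounded ⊊⇒⊂ (On.wellFounded tabulate ⊂-wellFounded)

  ⊋-wellFounded : WellFounded (flip _⊊_)
  ⊋-wellFounded = Subrelation.wellFounded ⊊⇒⊂ (On.wellFounded tabulate ⊃-wellFounded)

  anyPredicate? : ∀ {p} {P : (Fin n → Bool) → Set p} → Decidable P
                → (∀ {A B} → (∀ x → A x ≡ B x) → P A → P B) → Dec (∃ P)
  anyPredicate? P? resp =
    map′ (λ (S , PS) → lookup S , PS)
         (λ (A , PA) → tabulate A , resp (λ x → sym (lookup∘tabulate A x)) PA)
         (anySubset? (P? ∘ lookup))

  insert : Fin n → (Fin n → Bool) → Fin n → Bool
  insert c A x = does (x ≟ c) ∨ A x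

  insert-⊇ : ∀ c A → A ⊆ᵇ insert c A
  insert-⊇ c A x x∈A = trans (cong (does (x ≟ c) ∨_) x∈A) (Bool.∨-zeroʳ _)

  insert-∋ : ∀ c A → insert c A c ≡ true
  insert-∋ c A = cong (_∨ A c) (dec-true (c ≟ c) refl)

  insert-elim : ∀ c A x → insert c A x ≡ true → x ≡ c ⊎ A x ≡ true
  insert-elim c A x x∈ with x ≟ c
  ... | yes x≡c = inj₁ x≡c
  ... | no _ = inj₂ x∈

-- Transversals of decidable equivalence relations on Fin n

lookup-injective : ∀ {a} {A : Set a} {xs : List A} → Unique xs
                 → ∀ i j → List.lookup xs i ≡ List.lookup xs j → i ≡ j
lookup-injective (_ ∷ _) zero zero _ = refl
lookup-injective (x∉xs ∷ _) zero (suc j) eq = ⊥-elim (All.lookup x∉xs (∈-lookup j) eq)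
lookup-injective (x∉xs ∷ _) (suc i) zero eq = ⊥-elim (All.lookup x∉xs (∈-lookup i) (sym eq))
lookup-injective (_ ∷ xs-unique) (suc i) (suc j) eq = cong suc (lookup-injective xs-unique i j eq)

record Canonical {n ℓ} (R : Rel (Fin n) ℓ) : Set ℓ where
  field
    rep         : Fin n → Fin n
    rep-related : ∀ x → R (rep x) x
    rep-cong    : ∀ {x y} → R x y → rep x ≡ rep y

  rep-idem : ∀ x → rep (rep x) ≡ rep x
  rep-idem x = rep-cong (rep-related x)

-- The representative of a class is its least element.
canonical : ∀ {n ℓ} {R : Rel (Fin n) ℓ} → IsDecEquivalence R → Canonical R
canonical {zero} _ = record { rep = λ () ; rep-related = λ () ; rep-cong = λ { {()} } }
canonical {suc n} {R = R} isDecEq = record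
  { rep = rep ; rep-related = rep-related ; rep-cong = rep-cong }
  where
  open IsDecEquivalence isDecEq renaming (_≟_ to _R?_; refl to R-refl; sym to R-sym; trans to R-trans)
  module Tail = Canonical (canonical (On.isDecEquivalence suc isDecEq))

  repOfSuc : ∀ {x} → Dec (R zero (suc x)) → Fin (suc n)
  repOfSuc (yes _) = zero
  repOfSuc {x} (no _) = suc (Tail.rep x)

  rep : Fin (suc n) → Fin (suc n)
  rep zero = zero
  rep (suc x) = repOfSuc (zero R? suc x)

  repOfSuc-related : ∀ {x} (d : Dec (R zero (suc x))) → R (repOfSuc d) (suc x)
  repOfSuc-related (yes z~x) = z~x
  repOfSuc-related {x} (no _) = Tail.rep-related x

  rep-related : ∀ x → R (rep x) x
  rep-related zero = R-refl
  rep-related (suc x) = repOfSuc-related (zero R? suc x)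

  repOfSuc-zero : ∀ {x} → R zero (suc x) → (d : Dec (R zero (suc x))) → zero ≡ repOfSuc d
  repOfSuc-zero _ (yes _) = refl
  repOfSuc-zero z~x (no z≁x) = ⊥-elim (z≁x z~x)

  repOfSuc-cong : ∀ {x y} → R (suc x) (suc y)
                → (d : Dec (R zero (suc x))) (d′ : Dec (R zero (suc y))) → repOfSuc d ≡ repOfSuc d′
  repOfSuc-cong _ (yes _) (yes _) = refl
  repOfSuc-cong x~y (yes z~x) (no z≁y) = ⊥-elim (z≁y (R-trans z~x x~y))
  repOfSuc-cong x~y (no z≁x) (yes z~y) = ⊥-elim (z≁x (R-trans z~y (R-sym x~y)))
  repOfSuc-cong x~y (no _) (no _) = cong suc (Tail.rep-cong x~y)

  rep-cong : ∀ {x y} → R x y → rep x ≡ rep y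
  rep-cong {zero} {zero} _ = refl
  rep-cong {zero} {suc y} z~y = repOfSuc-zero z~y (zero R? suc y)
  rep-cong {suc x} {zero} x~z = sym (repOfSuc-zero (R-sym x~z) (zero R? suc x))
  rep-cong {suc x} {suc y} x~y = repOfSuc-cong x~y (zero R? suc x) (zero R? suc y)

record Transversal {n ℓ} (R : Rel (Fin n) ℓ) (D : Fin n → Bool) : Set ℓ where
  field
    size            : ℕ
    point           : Fin size → Fin n
    point∈          : ∀ a → D (point a) ≡ true
    classOf         : ∀ x → D x ≡ true → Fin size
    point-classOf   : ∀ x (x∈D : D x ≡ true) → R (point (classOf x x∈D)) x
    point-injective : ∀ a b → R (point a) (point b) → a ≡ b

opaque
  transversal : ∀ {n ℓ} {R : Rel (Fin n) ℓ} {D : Fin n → Bool} → IsDecEquivalence R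
              → (∀ {x y} → R x y → D y ≡ true → D x ≡ true) → Transversal R D
  transversal {n} {R = R} {D} isDecEq D-closed = record
    { size = length points
    ; point = List.lookup points
    ; point∈ = λ a → proj₂ (isPoint a)
    ; classOf = λ x x∈D → index (rep∈points x x∈D)
    ; point-classOf = λ x x∈D → subst (λ y → R y x) (lookup-index (rep∈points x x∈D)) (rep-related x)
    ; point-injective = λ a b a~b → lookup-injective points-unique a b (begin
        List.lookup points a        ≡⟨ proj₁ (isPoint a) ⟨
        rep (List.lookup points a)  ≡⟨ rep-cong a~b ⟩
        rep (List.lookup points b)  ≡⟨ proj₁ (isPoint b) ⟩
        List.lookup points b        ∎)
    }
    where
    open Canonical (canonical isDecEq)
    open ≡-Reasoning

    IsPoint : Fin n → Set
    IsPoint y = rep y ≡ y × D y ≡ true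

    isPoint? : Decidable IsPoint
    isPoint? y = rep y ≟ y ×-dec D y Bool.≟ true

    points : List (Fin n)
    points = filter isPoint? (allFin n)

    points-unique : Unique points
    points-unique = Unique.filter⁺ isPoint? (Unique.allFin⁺ n)

    isPoint : ∀ a → IsPoint (List.lookup points a)
    isPoint a = proj₂ (∈-filter⁻ isPoint? {xs = allFin n} (∈-lookup a))

    rep∈points : ∀ x → D x ≡ true → rep x ∈ₗ points
    rep∈points x x∈D = ∈-filter⁺ isPoint? (∈-allFin (rep x)) (rep-idem x , D-closed (rep-related x) x∈D)

-- Groups, homomorphisms and the correspondence theorem

module Laws (G : FinGroup) where
  open FinGroup G public

  group : Group 0ℓ 0ℓ
  group = record { isGroup = isGroup }

  open IsGroup isGroup public using (assoc; identityˡ; identityʳ; inverseˡ; inverseʳ)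
  open GroupProperties group public
    using (⁻¹-involutive; ⁻¹-anti-homo-∙; ε⁻¹≈ε; inverseʳ-unique
          ; \\-leftDividesˡ; \\-leftDividesʳ; //-rightDividesˡ; //-rightDividesʳ)
  open ≡-Reasoning

  idempotent⇒e : ∀ x → x · x ≡ x → x ≡ e
  idempotent⇒e x xx≡x = begin
    x                ≡⟨ \\-leftDividesʳ x x ⟨
    inv x · (x · x)  ≡⟨ cong (inv x ·_) xx≡x ⟩
    inv x · x        ≡⟨ inverseˡ x ⟩
    e                ∎

  x⁻¹∙y≈ε⇒x≈y : ∀ x y → inv x · y ≡ e → x ≡ y
  x⁻¹∙y≈ε⇒x≈y x y x⁻¹y≡e = begin
    x                ≡⟨ identityʳ x ⟨
    x · e            ≡⟨ cong (x ·_) x⁻¹y≡e ⟨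
    x · (inv x · y)  ≡⟨ \\-leftDividesˡ x y ⟩
    y                ∎

  cancelˡ-\\ : ∀ x y z → inv (x · y) · (x · z) ≡ inv y · z
  cancelˡ-\\ x y z = begin
    inv (x · y) · (x · z)        ≡⟨ cong (_· (x · z)) (⁻¹-anti-homo-∙ x y) ⟩
    (inv y · inv x) · (x · z)    ≡⟨ assoc _ _ _ ⟩
    inv y · (inv x · (x · z))    ≡⟨ cong (inv y ·_) (\\-leftDividesʳ x z) ⟩
    inv y · z                    ∎

  conj-e : ∀ x → (x · e) · inv x ≡ e
  conj-e x = trans (cong (_· inv x) (identityʳ x)) (inverseʳ x)

  commutative⇒commutator≡e : (∀ x y → x · y ≡ y · x) → ∀ x y → commutator G x y ≡ e
  commutative⇒commutator≡e comm x y = begin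
    ((inv x · inv y) · x) · y  ≡⟨ cong (λ z → (z · x) · y) (comm (inv x) (inv y)) ⟩
    ((inv y · inv x) · x) · y  ≡⟨ cong (_· y) (//-rightDividesˡ x (inv y)) ⟩
    inv y · y                  ≡⟨ inverseˡ y ⟩
    e                          ∎

whole : (G : FinGroup) → SubsetG G
whole G _ = true

whole-subgroup : ∀ G → IsSubgroup G (whole G)
whole-subgroup G = refl , (λ _ _ _ _ → refl) , λ _ _ → refl

IsSimple : FinGroup → Set
IsSimple S = ∀ N → IsNormalSubgroup S N → (∀ x → _∈_ S x N → x ≡ FinGroup.e S) ⊎ (∀ x → _∈_ S x N)

Nontrivial : FinGroup → Set
Nontrivial S = ∃[ s ] s ≢ FinGroup.e S

NoNormalBetween : (G : FinGroup) → SubsetG G → SubsetG G → Set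
NoNormalBetween G B X = ∀ M → IsSubgroup G M → _⊆_ G B M → _⊆_ G M X → IsNormalIn G M X
                      → _⊆_ G M B ⊎ _⊆_ G X M

module Trivial (G : FinGroup) where
  open Laws G

  trivial : SubsetG G
  trivial x = does (x ≟ e)

  trivial-elim : ∀ {x} → trivial x ≡ true → x ≡ e
  trivial-elim = from-does (_ ≟ e)

  trivial-intro : ∀ {x} → x ≡ e → trivial x ≡ true
  trivial-intro = dec-true (_ ≟ e)

  trivial-normal : IsNormalSubgroup G trivial
  trivial-normal =
    ( trivial-intro refl
    , (λ x y x∈ y∈ → trivial-intro (trans (cong₂ _·_ (trivial-elim x∈) (trivial-elim y∈)) (identityˡ e)))
    , (λ x x∈ → trivial-intro (trans (cong inv (trivial-elim x∈)) ε⁻¹≈ε)) )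
    , λ g x x∈ → trivial-intro (trans (cong (λ y → (g · y) · inv g) (trivial-elim x∈)) (conj-e g))

record Hom (G H : FinGroup) : Set where
  field
    ⟦_⟧  : Elt G → Elt H
    homo : ∀ x y → ⟦ FinGroup._·_ G x y ⟧ ≡ FinGroup._·_ H ⟦ x ⟧ ⟦ y ⟧

  private
    module G = Laws G
    module H = Laws H

  ε-homo : ⟦ G.e ⟧ ≡ H.e
  ε-homo = H.idempotent⇒e ⟦ G.e ⟧ (trans (sym (homo G.e G.e)) (cong ⟦_⟧ (G.identityˡ G.e)))

  ⁻¹-homo : ∀ x → ⟦ G.inv x ⟧ ≡ H.inv ⟦ x ⟧
  ⁻¹-homo x = H.inverseʳ-unique ⟦ x ⟧ ⟦ G.inv x ⟧
    (trans (sym (homo x (G.inv x))) (trans (cong ⟦_⟧ (G.inverseʳ x)) ε-homo))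

  conj-homo : ∀ g x → ⟦ (g G.· x) G.· G.inv g ⟧ ≡ (⟦ g ⟧ H.· ⟦ x ⟧) H.· H.inv ⟦ g ⟧
  conj-homo g x = trans (homo _ _) (cong₂ H._·_ (homo g x) (⁻¹-homo g))

  commutator-homo : ∀ x y → ⟦ commutator G x y ⟧ ≡ commutator H ⟦ x ⟧ ⟦ y ⟧
  commutator-homo x y =
    trans (homo _ y) (cong (H._· ⟦ y ⟧) (trans (homo _ x) (cong (H._· ⟦ x ⟧)
      (trans (homo _ _) (cong₂ H._·_ (⁻¹-homo x) (⁻¹-homo y))))))


module _ {G H : FinGroup} (φ : Hom G H) where
  open Hom φ
  private
    module G = Laws G
    module H = Laws H

  Surjective : Set
  Surjective = ∀ s → ∃[ x ] ⟦ x ⟧ ≡ s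

  IsKernel : SubsetG G → Set
  IsKernel N = ∀ x → ⟦ x ⟧ ≡ H.e ⇔ N x ≡ true

  image : SubsetG G → SubsetG H
  image M s = does (any? λ x → M x Bool.≟ true ×-dec ⟦ x ⟧ ≟ s)

  image-intro : ∀ {M x s} → M x ≡ true → ⟦ x ⟧ ≡ s → image M s ≡ true
  image-intro {x = x} x∈M ⟦x⟧≡s = dec-true (any? _) (x , x∈M , ⟦x⟧≡s)

  image-elim : ∀ {M s} → image M s ≡ true → ∃[ x ] (M x ≡ true × ⟦ x ⟧ ≡ s)
  image-elim = from-does (any? _)

  image-subgroup : ∀ {M} → IsSubgroup G M → IsSubgroup H (image M)
  image-subgroup {M} (e∈M , ·-closed , inv-closed) =
      image-intro e∈M ε-homo
    , (λ s t s∈ t∈ → ·-case (image-elim s∈) (image-elim t∈))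
    , (λ s s∈ → inv-case (image-elim s∈))
    where
    ·-case : ∀ {s t} → ∃[ x ] (M x ≡ true × ⟦ x ⟧ ≡ s) → ∃[ y ] (M y ≡ true × ⟦ y ⟧ ≡ t)
           → image M (s H.· t) ≡ true
    ·-case (x , x∈M , refl) (y , y∈M , refl) = image-intro (·-closed x y x∈M y∈M) (homo x y)
    inv-case : ∀ {s} → ∃[ x ] (M x ≡ true × ⟦ x ⟧ ≡ s) → image M (H.inv s) ≡ true
    inv-case (x , x∈M , refl) = image-intro (inv-closed x x∈M) (⁻¹-homo x)

  image-normal : ∀ {M} → Surjective → IsNormalSubgroup G M → IsNormalSubgroup H (image M)
  image-normal {M} surj (M-subgroup , M-normal) = image-subgroup M-subgroup , λ t s s∈ → conj-case (surj t) (image-elim s∈)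
    where
    conj-case : ∀ {t s} → ∃[ g ] ⟦ g ⟧ ≡ t → ∃[ x ] (M x ≡ true × ⟦ x ⟧ ≡ s)
              → image M ((t H.· s) H.· H.inv t) ≡ true
    conj-case (g , refl) (x , x∈M , refl) = image-intro (M-normal g x x∈M) (conj-homo g x)

  preimage : SubsetG H → SubsetG G
  preimage N = N ∘ ⟦_⟧

  preimage-normal : ∀ {N} → IsNormalSubgroup H N → IsNormalSubgroup G (preimage N)
  preimage-normal {N} ((e∈N , ·-closed , inv-closed) , N-normal) =
      ( subst∈ (sym ε-homo) e∈N
      , (λ x y x∈ y∈ → subst∈ (sym (homo x y)) (·-closed _ _ x∈ y∈))
      , (λ x x∈ → subst∈ (sym (⁻¹-homo x)) (inv-closed _ x∈)) )
    , λ g x x∈ → subst∈ (sym (conj-homo g x)) (N-normal _ _ x∈)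
    where
    subst∈ : ∀ {s t} → s ≡ t → N s ≡ true → N t ≡ true
    subst∈ eq = subst (λ u → N u ≡ true) eq

  module _ (surj : Surjective) {K : SubsetG G} (K-kernel : IsKernel K) where
    private
      kernel-intro : ∀ {x} → ⟦ x ⟧ ≡ H.e → K x ≡ true
      kernel-intro = Equivalence.to (K-kernel _)
      kernel-elim : ∀ {x} → K x ≡ true → ⟦ x ⟧ ≡ H.e
      kernel-elim = Equivalence.from (K-kernel _)

    simple⇒kernel-maximal : IsSimple H → NoNormalBetween G K (whole G)
    simple⇒kernel-maximal simple M M-subgroup K⊆M _ M-normal
      with simple (image M) (image-normal surj (M-subgroup , λ g x → M-normal g x refl))
    ... | inj₁ image-trivial = inj₁ λ x x∈M → kernel-intro (image-trivial ⟦ x ⟧ (image-intro x∈M refl))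
    ... | inj₂ image-whole = inj₂ λ x _ → fromFibre (image-elim (image-whole ⟦ x ⟧))
      where
      fromFibre : ∀ {x} → ∃[ y ] (M y ≡ true × ⟦ y ⟧ ≡ ⟦ x ⟧) → M x ≡ true
      fromFibre {x} (y , y∈M , ⟦y⟧≡⟦x⟧) = subst (λ z → M z ≡ true) (G.\\-leftDividesˡ y x)
        (proj₁ (proj₂ M-subgroup) y _ y∈M (K⊆M _ (kernel-intro (begin
          ⟦ G.inv y G.· x ⟧         ≡⟨ homo _ x ⟩
          ⟦ G.inv y ⟧ H.· ⟦ x ⟧     ≡⟨ cong₂ H._·_ (⁻¹-homo y) (sym ⟦y⟧≡⟦x⟧) ⟩
          H.inv ⟦ y ⟧ H.· ⟦ y ⟧     ≡⟨ H.inverseˡ ⟦ y ⟧ ⟩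
          H.e                       ∎))))
        where open ≡-Reasoning

    kernel-maximal⇒simple : NoNormalBetween G K (whole G) → IsSimple H
    kernel-maximal⇒simple maximal N N-normal
      with maximal (preimage N) (proj₁ (preimage-normal N-normal))
             (λ x x∈K → subst (λ s → N s ≡ true) (sym (kernel-elim x∈K)) (proj₁ (proj₁ N-normal)))
             (λ _ _ → refl) (λ g x _ → proj₂ (preimage-normal N-normal) g x)
    ... | inj₁ preimage⊆K = inj₁ λ s s∈N → fibre (surj s) s∈N
      where
      fibre : ∀ {s} → ∃[ x ] ⟦ x ⟧ ≡ s → N s ≡ true → s ≡ H.e
      fibre (x , refl) s∈N = kernel-elim (preimage⊆K x s∈N)
    ... | inj₂ whole⊆preimage = inj₂ λ s → fibre (surj s)
      where
      fibre : ∀ {s} → ∃[ x ] ⟦ x ⟧ ≡ s → N s ≡ true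
      fibre (x , refl) = whole⊆preimage x refl

-- Cosets and quotient groups

module Cosets (G : FinGroup) {N : SubsetG G} (N-subgroup : IsSubgroup G N) where
  open Laws G

  private
    e∈N = proj₁ N-subgroup
    ·-closed = proj₁ (proj₂ N-subgroup)
    inv-closed = proj₂ (proj₂ N-subgroup)

  _∈N : Elt G → Set
  x ∈N = N x ≡ true

  subst∈N : ∀ {x y} → x ≡ y → x ∈N → y ∈N
  subst∈N eq = subst _∈N eq

  _~_ : Elt G → Elt G → Set
  x ~ y = (inv x · y) ∈N

  ~-refl : ∀ {x} → x ~ x
  ~-refl {x} = subst∈N (sym (inverseˡ x)) e∈N

  ~-sym : ∀ {x y} → x ~ y → y ~ x
  ~-sym {x} {y} x~y = subst∈N (trans (⁻¹-anti-homo-∙ (inv x) y) (cong (inv y ·_) (⁻¹-involutive x)))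
                              (inv-closed _ x~y)

  ~-trans : ∀ {x y z} → x ~ y → y ~ z → x ~ z
  ~-trans {x} {y} {z} x~y y~z = subst∈N (trans (assoc _ _ _) (cong (inv x ·_) (\\-leftDividesˡ y z)))
                                        (·-closed _ _ x~y y~z)

  ~-isDecEquivalence : IsDecEquivalence _~_
  ~-isDecEquivalence = record
    { isEquivalence = record { refl = ~-refl ; sym = ~-sym ; trans = ~-trans }
    ; _≟_ = λ x y → N (inv x · y) Bool.≟ true
    }

module Quotient (G : FinGroup) {N : SubsetG G} (N-normal : IsNormalSubgroup G N) where
  open Laws G
  open Cosets G (proj₁ N-normal) public
  open ≡-Reasoning

  private
    ·-closed = proj₁ (proj₂ (proj₁ N-normal))
    inv-closed = proj₂ (proj₂ (proj₁ N-normal))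
    conj-closed = proj₂ N-normal

  -- x⁻¹x′ and y⁻¹y′ lie in N, hence so does y⁻¹(x⁻¹x′)y · y⁻¹y′ = (xy)⁻¹(x′y′).
  ·-cong : ∀ {x x′ y y′} → x ~ x′ → y ~ y′ → (x · y) ~ (x′ · y′)
  ·-cong {x} {x′} {y} {y′} x~x′ y~y′ =
    subst∈N lemma (·-closed _ _ (conj-closed (inv y) _ x~x′) y~y′)
    where
    lemma : ((inv y · (inv x · x′)) · inv (inv y)) · (inv y · y′) ≡ inv (x · y) · (x′ · y′)
    lemma = begin
      ((inv y · (inv x · x′)) · inv (inv y)) · (inv y · y′)  ≡⟨ assoc _ _ _ ⟩
      (inv y · (inv x · x′)) · (inv (inv y) · (inv y · y′))  ≡⟨ cong ((inv y · (inv x · x′)) ·_) (\\-leftDividesʳ (inv y) y′) ⟩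
      (inv y · (inv x · x′)) · y′                            ≡⟨ assoc _ _ _ ⟩
      inv y · ((inv x · x′) · y′)                            ≡⟨ cong (inv y ·_) (assoc _ _ _) ⟩
      inv y · (inv x · (x′ · y′))                            ≡⟨ assoc _ _ _ ⟨
      (inv y · inv x) · (x′ · y′)                            ≡⟨ cong (_· (x′ · y′)) (⁻¹-anti-homo-∙ x y) ⟨
      inv (x · y) · (x′ · y′)                                ∎

  -- The inverse of the conjugate x(x⁻¹x′)x⁻¹ = x′x⁻¹ is (x⁻¹)⁻¹x′⁻¹.
  inv-cong : ∀ {x x′} → x ~ x′ → inv x ~ inv x′
  inv-cong {x} {x′} x~x′ = subst∈N lemma (inv-closed _ (conj-closed x _ x~x′))
    where
    lemma : inv ((x · (inv x · x′)) · inv x) ≡ inv (inv x) · inv x′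
    lemma = trans (cong (λ z → inv (z · inv x)) (\\-leftDividesˡ x x′)) (⁻¹-anti-homo-∙ x′ (inv x))

  private
    module T = Transversal (transversal {D = whole G} ~-isDecEquivalence (λ _ _ → refl))

  order/ : ℕ
  order/ = T.size

  π⟦_⟧ : Elt G → Fin order/
  π⟦ x ⟧ = T.classOf x refl

  lift : Fin order/ → Elt G
  lift = T.point

  lift~ : ∀ x → lift π⟦ x ⟧ ~ x
  lift~ x = T.point-classOf x refl

  π-cong : ∀ {x y} → x ~ y → π⟦ x ⟧ ≡ π⟦ y ⟧
  π-cong {x} {y} x~y = T.point-injective _ _ (~-trans (lift~ x) (~-trans x~y (~-sym (lift~ y))))

  π-reflects : ∀ {x y} → π⟦ x ⟧ ≡ π⟦ y ⟧ → x ~ y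
  π-reflects {x} {y} eq = ~-trans (~-sym (lift~ x)) (subst (λ a → lift a ~ y) (sym eq) (lift~ y))

  π-lift : ∀ a → π⟦ lift a ⟧ ≡ a
  π-lift a = T.point-injective _ _ (lift~ (lift a))

  _·/_ : Fin order/ → Fin order/ → Fin order/
  a ·/ b = π⟦ lift a · lift b ⟧

  e/ : Fin order/
  e/ = π⟦ e ⟧

  inv/ : Fin order/ → Fin order/
  inv/ a = π⟦ inv (lift a) ⟧

  π-homo : ∀ x y → π⟦ x · y ⟧ ≡ π⟦ x ⟧ ·/ π⟦ y ⟧
  π-homo x y = π-cong (·-cong (~-sym (lift~ x)) (~-sym (lift~ y)))

  π-inv : ∀ x → π⟦ inv x ⟧ ≡ inv/ π⟦ x ⟧
  π-inv x = π-cong (inv-cong (~-sym (lift~ x)))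

  private
    ·/-π : ∀ x y → π⟦ x ⟧ ·/ π⟦ y ⟧ ≡ π⟦ x · y ⟧
    ·/-π x y = sym (π-homo x y)

    π-onto : ∀ a → ∃[ x ] π⟦ x ⟧ ≡ a
    π-onto a = lift a , π-lift a

  ·/-assoc : ∀ a b c → (a ·/ b) ·/ c ≡ a ·/ (b ·/ c)
  ·/-assoc a b c with π-onto a | π-onto b | π-onto c
  ... | x , refl | y , refl | z , refl = begin
    (π⟦ x ⟧ ·/ π⟦ y ⟧) ·/ π⟦ z ⟧   ≡⟨ cong (_·/ π⟦ z ⟧) (·/-π x y) ⟩
    π⟦ x · y ⟧ ·/ π⟦ z ⟧          ≡⟨ ·/-π _ z ⟩
    π⟦ (x · y) · z ⟧              ≡⟨ cong π⟦_⟧ (assoc x y z) ⟩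
    π⟦ x · (y · z) ⟧              ≡⟨ ·/-π x _ ⟨
    π⟦ x ⟧ ·/ π⟦ y · z ⟧          ≡⟨ cong (π⟦ x ⟧ ·/_) (·/-π y z) ⟨
    π⟦ x ⟧ ·/ (π⟦ y ⟧ ·/ π⟦ z ⟧)   ∎

  ·/-identityˡ : ∀ a → e/ ·/ a ≡ a
  ·/-identityˡ a with π-onto a
  ... | x , refl = trans (·/-π e x) (cong π⟦_⟧ (identityˡ x))

  ·/-identityʳ : ∀ a → a ·/ e/ ≡ a
  ·/-identityʳ a with π-onto a
  ... | x , refl = trans (·/-π x e) (cong π⟦_⟧ (identityʳ x))

  ·/-inverseˡ : ∀ a → inv/ a ·/ a ≡ e/
  ·/-inverseˡ a with π-onto a
  ... | x , refl = trans (cong (_·/ π⟦ x ⟧) (sym (π-inv x))) (trans (·/-π (inv x) x) (cong π⟦_⟧ (inverseˡ x)))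

  ·/-inverseʳ : ∀ a → a ·/ inv/ a ≡ e/
  ·/-inverseʳ a with π-onto a
  ... | x , refl = trans (cong (π⟦ x ⟧ ·/_) (sym (π-inv x))) (trans (·/-π x (inv x)) (cong π⟦_⟧ (inverseʳ x)))

  G/N : FinGroup
  G/N = record
    { order = order/ ; _·_ = _·/_ ; e = e/ ; inv = inv/
    ; isGroup = record
      { isMonoid = record
        { isSemigroup = record
          { isMagma = record { isEquivalence = isEquivalence ; ∙-cong = cong₂ _·/_ }
          ; assoc = ·/-assoc }
        ; identity = ·/-identityˡ , ·/-identityʳ }
      ; inverse = ·/-inverseˡ , ·/-inverseʳ
      ; ⁻¹-cong = cong inv/ }
    }

  π : Hom G G/N
  π = record { ⟦_⟧ = π⟦_⟧ ; homo = π-homo }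

  π-surjective : Surjective π
  π-surjective = π-onto

  π-kernel : IsKernel π N
  π-kernel x = mk⇔
    (λ πx≡e → subst∈N (identityˡ x) (subst (λ y → (y · x) ∈N) ε⁻¹≈ε (π-reflects (sym πx≡e))))
    (λ x∈N → sym (π-cong (subst∈N (sym (trans (cong (_· x) ε⁻¹≈ε) (identityˡ x))) x∈N)))

-- Maximal normal subgroups and composition series

module _ (G : FinGroup) where
  open Laws G

  private
    _∈?_ : ∀ x (A : SubsetG G) → Dec (A x ≡ true)
    x ∈? A = A x Bool.≟ true

  isSubgroup? : Decidable (IsSubgroup G)
  isSubgroup? A = (e ∈? A)
    ×-dec all? (λ x → all? λ y → (x ∈? A) →-dec (y ∈? A) →-dec ((x · y) ∈? A))
    ×-dec all? (λ x → (x ∈? A) →-dec (inv x ∈? A))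

  isNormalIn? : ∀ B X → Dec (IsNormalIn G B X)
  isNormalIn? B X = all? λ g → all? λ x → (g ∈? X) →-dec (x ∈? B) →-dec (((g · x) · inv g) ∈? B)

  ProperIn : SubsetG G → SubsetG G → Set
  ProperIn B X = ∃[ x ] (X x ≡ true × ¬ B x ≡ true)

  properIn? : ∀ B X → Dec (ProperIn B X)
  properIn? B X = any? λ x → (x ∈? X) ×-dec (¬? (x ∈? B))

  record ProperNormalIn (X B : SubsetG G) : Set where
    field
      subgroup : IsSubgroup G B
      ⊆X       : B ⊆ᵇ X
      normal   : IsNormalIn G B X
      proper   : ProperIn B X

  record MaximalNormalIn (X B : SubsetG G) : Set where
    field
      properNormal : ProperNormalIn X B
      maximal      : NoNormalBetween G B X
    open ProperNormalIn properNormal public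

  private
    properNormalIn? : ∀ X B → Dec (ProperNormalIn X B)
    properNormalIn? X B = map′
      (λ (s , b , c , d) → record { subgroup = s ; ⊆X = b ; normal = c ; proper = d })
      (λ p → let open ProperNormalIn p in subgroup , ⊆X , normal , proper)
      (isSubgroup? B ×-dec B ⊆ᵇ? X ×-dec isNormalIn? B X ×-dec properIn? B X)

    properNormalIn-resp : ∀ {X B B′} → (∀ x → B x ≡ B′ x) → ProperNormalIn X B → ProperNormalIn X B′
    properNormalIn-resp {B = B} {B′} B≗B′ p = record
      { subgroup = ≗⇒⊆ B≗B′ _ e∈B
                 , (λ x y x∈ y∈ → ≗⇒⊆ B≗B′ _ (·-closed x y (≗⇒⊆ B≗B′⁻¹ _ x∈) (≗⇒⊆ B≗B′⁻¹ _ y∈)))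
                 , (λ x x∈ → ≗⇒⊆ B≗B′ _ (inv-closed x (≗⇒⊆ B≗B′⁻¹ _ x∈)))
      ; ⊆X = λ x → ⊆X x ∘ ≗⇒⊆ B≗B′⁻¹ _
      ; normal = λ g x g∈ x∈ → ≗⇒⊆ B≗B′ _ (normal g x g∈ (≗⇒⊆ B≗B′⁻¹ _ x∈))
      ; proper = let (x , x∈X , x∉B) = proper in x , x∈X , x∉B ∘ ≗⇒⊆ B≗B′⁻¹ _
      }
      where
      open ProperNormalIn p
      B≗B′⁻¹ = λ x → sym (B≗B′ x)
      e∈B = proj₁ subgroup
      ·-closed = proj₁ (proj₂ subgroup)
      inv-closed = proj₂ (proj₂ subgroup)

  opaque
    maximalNormalAbove : ∀ {X A} → ProperNormalIn X A → ∃[ B ] (A ⊆ᵇ B × MaximalNormalIn X B)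
    maximalNormalAbove {X} {A} A-properNormal = climb A (⊋-wellFounded A) A-properNormal
      where
      climb : ∀ B → Acc (flip _⊊_) B → ProperNormalIn X B → ∃[ B′ ] (B ⊆ᵇ B′ × MaximalNormalIn X B′)
      climb B (acc rec) B-properNormal
        with anyPredicate? (λ M → properNormalIn? X M ×-dec B ⊊? M)
               (λ M≗M′ (M-pn , B⊊M) → properNormalIn-resp M≗M′ M-pn , ⊊-respʳ M≗M′ B⊊M)
      ... | yes (M , M-properNormal , B⊊M) =
        let (B′ , M⊆B′ , B′-maximal) = climb M (rec B⊊M) M-properNormal
        in B′ , (λ x → M⊆B′ x ∘ proj₁ B⊊M x) , B′-maximal
      ... | no noneAbove = B , (λ _ → id) , record { properNormal = B-properNormal ; maximal = maximal }
        where
        maximal : NoNormalBetween G B X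
        maximal M M-subgroup B⊆M M⊆X M-normal with M ⊆ᵇ? B | X ⊆ᵇ? M
        ... | yes M⊆B | _ = inj₁ M⊆B
        ... | no _ | yes X⊆M = inj₂ X⊆M
        ... | no M⊈B | no X⊈M = ⊥-elim (noneAbove (M
          , record { subgroup = M-subgroup ; ⊆X = M⊆X ; normal = M-normal ; proper = ⊈⇒∃ X⊈M }
          , B⊆M , ⊈⇒∃ M⊈B))

  record SeriesOf (X : SubsetG G) : Set where
    field
      len     : ℕ
      N       : Fin (suc len) → SubsetG G
      head    : N zero ≡ X
      subgrp  : ∀ j → IsSubgroup G (N j)
      bottom  : ∀ x → _∈_ G x (N (fromℕ len)) → x ≡ e
      sub     : ∀ (j : Fin len) → _⊆_ G (N (suc j)) (N (inject₁ j))
      normal  : ∀ (j : Fin len) → IsNormalIn G (N (suc j)) (N (inject₁ j))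
      proper  : ∀ (j : Fin len) → ProperIn (N (suc j)) (N (inject₁ j))
      maximal : ∀ (j : Fin len) → NoNormalBetween G (N (suc j)) (N (inject₁ j))

  trivialSeries : ∀ {X} → IsSubgroup G X → (∀ x → X x ≡ true → x ≡ e) → SeriesOf X
  trivialSeries {X} X-subgroup X-trivial = record
    { len = 0 ; N = λ _ → X ; head = refl ; subgrp = λ _ → X-subgroup ; bottom = X-trivial
    ; sub = λ () ; normal = λ () ; proper = λ () ; maximal = λ () }

  prepend : ∀ {X B} → IsSubgroup G X → MaximalNormalIn X B → SeriesOf B → SeriesOf X
  prepend {X} {B} X-subgroup B-maximal S = record
    { len = suc len
    ; N = N′
    ; head = refl
    ; subgrp = λ { zero → X-subgroup ; (suc j) → subgrp j }
    ; bottom = bottom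
    ; sub = λ { zero → subst (λ A → A ⊆ᵇ X) (sym head) B.⊆X ; (suc j) → sub j }
    ; normal = λ { zero → subst (λ A → IsNormalIn G A X) (sym head) B.normal ; (suc j) → normal j }
    ; proper = λ { zero → subst (λ A → ProperIn A X) (sym head) B.proper ; (suc j) → proper j }
    ; maximal = λ { zero → subst (λ A → NoNormalBetween G A X) (sym head) B.maximal ; (suc j) → maximal j }
    }
    where
    open SeriesOf S
    module B = MaximalNormalIn B-maximal
    N′ : Fin (suc (suc len)) → SubsetG G
    N′ zero = X
    N′ (suc j) = N j

  opaque
    seriesOf : ∀ X → IsSubgroup G X → SeriesOf X
    seriesOf X = go X (⊊-wellFounded X)
      where
      open Trivial G
      go : ∀ X → Acc _⊊_ X → IsSubgroup G X → SeriesOf X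
      go X (acc rec) X-subgroup with X ⊆ᵇ? trivial
      ... | yes X⊆trivial = trivialSeries X-subgroup (λ x → trivial-elim ∘ X⊆trivial x)
      ... | no X-nontrivial =
        let (B , _ , B-maximal) = maximalNormalAbove trivialProperNormal
            open MaximalNormalIn B-maximal
        in prepend X-subgroup B-maximal (go B (rec (⊆X , proper)) subgroup)
        where
        trivialProperNormal : ProperNormalIn X trivial
        trivialProperNormal = record
          { subgroup = proj₁ trivial-normal
          ; ⊆X = λ x x∈ → subst (λ y → X y ≡ true) (sym (trivial-elim x∈)) (proj₁ X-subgroup)
          ; normal = λ g x _ → proj₂ trivial-normal g x
          ; proper = ⊈⇒∃ X-nontrivial
          }

toCompositionSeries : ∀ {G} → SeriesOf G (whole G) → CompositionSeries G
toCompositionSeries S = record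
  { len = len ; N = N ; subgrp = subgrp ; top = λ x → subst (λ A → A x ≡ true) (sym head) refl
  ; bottom = bottom ; sub = sub ; normal = normal ; proper = proper ; maximal = maximal }
  where open SeriesOf S

-- The kernel of G ↠ S is a maximal normal subgroup; a composition series of G through
-- it has S as its first factor.
surjection⇒occurs : ∀ {G S} (φ : Hom G S) → Surjective φ → IsSimple S → Nontrivial S → OccursAsFactor G S
surjection⇒occurs {G} {S} φ surj simple (s , s≢e) =
  toCompositionSeries series , zero , subst (λ A → QuotientIso G (whole G) A S) (sym (SeriesOf.head K-series)) iso
  where
  open Hom φ
  open Trivial S
  K = preimage φ trivial
  K-normal = preimage-normal φ trivial-normal
  K-kernel : IsKernel φ K
  K-kernel x = mk⇔ trivial-intro trivial-elim

  K-maximal : MaximalNormalIn G (whole G) K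
  K-maximal = record
    { properNormal = record
      { subgroup = proj₁ K-normal
      ; ⊆X = λ _ _ → refl
      ; normal = λ g x _ → proj₂ K-normal g x
      ; proper = let (x , ⟦x⟧≡s) = surj s in x , refl , λ x∈K → s≢e (trans (sym ⟦x⟧≡s) (trivial-elim x∈K)) }
    ; maximal = simple⇒kernel-maximal φ surj K-kernel simple
    }

  K-series = seriesOf G K (proj₁ K-normal)
  series = prepend G (whole-subgroup G) K-maximal K-series

  iso : QuotientIso G (whole G) K S
  iso = ⟦_⟧ , (λ x y _ _ → homo x y) , (λ t → let (x , ⟦x⟧≡t) = surj t in x , refl , ⟦x⟧≡t)
      , λ x _ → Equivalence.to (K-kernel x) , Equivalence.from (K-kernel x)

-- The derived subgroup and the order of the abelianization

module DerivedSubgroup (G : FinGroup) where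
  open Laws G
  open ≡-Reasoning

  private
    ⁅_,_⁆ : Elt G → Elt G → Elt G
    ⁅_,_⁆ = commutator G

    C : Elt G → Set
    C = ProdOfComms G

  C-· : ∀ {x y} → C x → C y → C (x · y)
  C-· {y = y} nil Cy = subst C (sym (identityˡ y)) Cy
  C-· {y = y} (cons a b {z} Cz) Cy = subst C (sym (assoc _ z y)) (cons a b (C-· Cz Cy))

  commutator-inv : ∀ x y → inv ⁅ x , y ⁆ ≡ ⁅ y , x ⁆
  commutator-inv x y = begin
    inv (((inv x · inv y) · x) · y)       ≡⟨ ⁻¹-anti-homo-∙ _ y ⟩
    inv y · inv ((inv x · inv y) · x)     ≡⟨ cong (inv y ·_) (⁻¹-anti-homo-∙ _ x) ⟩
    inv y · (inv x · inv (inv x · inv y)) ≡⟨ cong (λ z → inv y · (inv x · z)) (⁻¹-anti-homo-∙ (inv x) (inv y)) ⟩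
    inv y · (inv x · (inv (inv y) · inv (inv x)))
      ≡⟨ cong (λ z → inv y · (inv x · z)) (cong₂ _·_ (⁻¹-involutive y) (⁻¹-involutive x)) ⟩
    inv y · (inv x · (y · x))             ≡⟨ assoc _ _ _ ⟨
    (inv y · inv x) · (y · x)             ≡⟨ assoc _ _ _ ⟨
    ((inv y · inv x) · y) · x             ∎

  C-inv : ∀ {x} → C x → C (inv x)
  C-inv nil = subst C (sym ε⁻¹≈ε) nil
  C-inv (cons a b {z} Cz) = subst C lemma (C-· (C-inv Cz) (cons b a nil))
    where
    lemma : inv z · (⁅ b , a ⁆ · e) ≡ inv (⁅ a , b ⁆ · z)
    lemma = begin
      inv z · (⁅ b , a ⁆ · e)   ≡⟨ cong (inv z ·_) (trans (identityʳ _) (sym (commutator-inv a b))) ⟩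
      inv z · inv ⁅ a , b ⁆     ≡⟨ ⁻¹-anti-homo-∙ _ z ⟨
      inv (⁅ a , b ⁆ · z)       ∎

  private
    open Trivial G

    record Saturated : Set where
      field
        set    : SubsetG G
        sound  : ∀ {z} → set z ≡ true → C z
        ∋e     : set e ≡ true
        closed : ∀ x y {z} → set z ≡ true → set (⁅ x , y ⁆ · z) ≡ true

    saturate : ∀ A → Acc (flip _⊊_) A → (∀ {z} → A z ≡ true → C z) → A e ≡ true → Saturated
    saturate A (acc rec) A-sound e∈A
      with any? (λ x → any? λ y → any? λ z → (A z Bool.≟ true) ×-dec ¬? (A (⁅ x , y ⁆ · z) Bool.≟ true))
    ... | yes (x , y , z , z∈A , c∉A) =
      saturate (insert c A) (rec (insert-⊇ c A , c , insert-∋ c A , c∉A)) A′-sound (insert-⊇ c A e e∈A)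
      where
      c = ⁅ x , y ⁆ · z
      A′-sound : ∀ {w} → insert c A w ≡ true → C w
      A′-sound {w} w∈ with insert-elim c A w w∈
      ... | inj₁ refl = cons x y (A-sound z∈A)
      ... | inj₂ w∈A = A-sound w∈A
    ... | no nothingMissing = record { set = A ; sound = A-sound ; ∋e = e∈A ; closed = closed }
      where
      closed : ∀ x y {z} → A z ≡ true → A (⁅ x , y ⁆ · z) ≡ true
      closed x y {z} z∈A with A (⁅ x , y ⁆ · z) Bool.≟ true
      ... | yes c∈A = c∈A
      ... | no c∉A = ⊥-elim (nothingMissing (x , y , z , z∈A , c∉A))

    opaque
      saturation : Saturated
      saturation = saturate trivial (⊋-wellFounded trivial) (λ z∈ → subst C (sym (trivial-elim z∈)) nil) (trivial-intro refl)

    open Saturated saturation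

  derived : SubsetG G
  derived = set

  derived-sound : ∀ {z} → derived z ≡ true → C z
  derived-sound = sound

  derived-complete : ∀ {z} → C z → derived z ≡ true
  derived-complete nil = ∋e
  derived-complete (cons x y Cz) = closed x y (derived-complete Cz)

  derived-subgroup : IsSubgroup G derived
  derived-subgroup = derived-complete nil
                   , (λ x y x∈ y∈ → derived-complete (C-· (derived-sound x∈) (derived-sound y∈)))
                   , (λ x x∈ → derived-complete (C-inv (derived-sound x∈)))

abelianizationOrder-× : ∀ {G m c} (ρ : Fin m × Fin c → Elt G)
  → (∀ p q → ProdOfComms G (FinGroup._·_ G (FinGroup.inv G (ρ p)) (ρ q)) → p ≡ q)
  → (∀ x → ∃[ p ] ProdOfComms G (FinGroup._·_ G (FinGroup.inv G (ρ p)) x))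
  → AbelianizationOrder G (m * c)
abelianizationOrder-× {G} {m} {c} ρ distinct cover =
  ρ ∘ remQuot c , (λ i j → remQuot-injective i j ∘ distinct _ _) , cover′ ∘ cover
  where
  open FinGroup G
  cover′ : ∀ {x} → ∃[ p ] ProdOfComms G (inv (ρ p) · x) → ∃[ i ] ProdOfComms G (inv (ρ (remQuot c i)) · x)
  cover′ {x} ((a , b) , Cp) = combine a b , subst (λ q → ProdOfComms G (inv (ρ q) · x)) (sym (remQuot-combine a b)) Cp

  remQuot-injective : ∀ i j → remQuot {m} c i ≡ remQuot c j → i ≡ j
  remQuot-injective i j eq =
    trans (sym (combine-remQuot {m} c i)) (trans (cong (uncurry combine) eq) (combine-remQuot {m} c j))

-- Fix a transversal of G′ inside the kernel K of φ; together with a section of φ it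
-- gives a transversal of G′ in G indexed by S × (K / G′).
surjection⇒abelianizationOrder : ∀ {G S} (φ : Hom G S) → Surjective φ
  → (∀ a b → FinGroup._·_ S a b ≡ FinGroup._·_ S b a)
  → ∃[ c ] AbelianizationOrder G (FinGroup.order S * c)
surjection⇒abelianizationOrder {G} {S} φ surj S-comm =
  T.size , abelianizationOrder-× ρ distinct cover
  where
  open Laws G
  module S = Laws S
  open Hom φ
  open DerivedSubgroup G
  open Cosets G derived-subgroup
  open Trivial S
  open ≡-Reasoning

  ⟦\\⟧ : ∀ x y → ⟦ inv x · y ⟧ ≡ S.inv ⟦ x ⟧ S.· ⟦ y ⟧
  ⟦\\⟧ x y = trans (homo _ y) (cong (S._· ⟦ y ⟧) (⁻¹-homo x))

  derived⇒⟦⟧≡e : ∀ {z} → ProdOfComms G z → ⟦ z ⟧ ≡ S.e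
  derived⇒⟦⟧≡e nil = ε-homo
  derived⇒⟦⟧≡e (cons x y {z} Cz) = begin
    ⟦ commutator G x y · z ⟧              ≡⟨ homo _ z ⟩
    ⟦ commutator G x y ⟧ S.· ⟦ z ⟧        ≡⟨ cong₂ S._·_ (commutator-homo x y) (derived⇒⟦⟧≡e Cz) ⟩
    commutator S ⟦ x ⟧ ⟦ y ⟧ S.· S.e      ≡⟨ cong (S._· S.e) (S.commutative⇒commutator≡e S-comm _ _) ⟩
    S.e S.· S.e                           ≡⟨ S.identityˡ S.e ⟩
    S.e                                   ∎

  ~⇒⟦⟧≡ : ∀ {x y} → x ~ y → ⟦ x ⟧ ≡ ⟦ y ⟧
  ~⇒⟦⟧≡ {x} {y} x~y = S.x⁻¹∙y≈ε⇒x≈y _ _ (trans (sym (⟦\\⟧ x y)) (derived⇒⟦⟧≡e (derived-sound x~y)))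

  K = preimage φ trivial

  module T = Transversal (transversal {D = K} ~-isDecEquivalence (λ x~y → trans (cong trivial (~⇒⟦⟧≡ x~y))))

  section : Elt S → Elt G
  section a = proj₁ (surj a)

  ρ : Elt S × Fin T.size → Elt G
  ρ (a , b) = section a · T.point b

  ⟦ρ⟧ : ∀ p → ⟦ ρ p ⟧ ≡ proj₁ p
  ⟦ρ⟧ (a , b) = begin
    ⟦ section a · T.point b ⟧        ≡⟨ homo _ _ ⟩
    ⟦ section a ⟧ S.· ⟦ T.point b ⟧  ≡⟨ cong₂ S._·_ (proj₂ (surj a)) (trivial-elim (T.point∈ b)) ⟩
    a S.· S.e                        ≡⟨ S.identityʳ a ⟩
    a                                ∎

  distinct : ∀ p q → ProdOfComms G (inv (ρ p) · ρ q) → p ≡ q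
  distinct (a , b) (a′ , b′) C with trans (sym (⟦ρ⟧ (a , b))) (trans (~⇒⟦⟧≡ (derived-complete C)) (⟦ρ⟧ (a′ , b′)))
  ... | refl = cong (a ,_) (T.point-injective b b′ (derived-complete
                 (subst (ProdOfComms G) (cancelˡ-\\ (section a) (T.point b) (T.point b′)) C)))

  cover : ∀ x → ∃[ p ] ProdOfComms G (inv (ρ p) · x)
  cover x = (⟦ x ⟧ , b) , subst (ProdOfComms G) regroup (derived-sound (T.point-classOf y y∈K))
    where
    y = inv (section ⟦ x ⟧) · x
    y∈K : K y ≡ true
    y∈K = trivial-intro (trans (⟦\\⟧ _ x) (trans (cong (λ s → S.inv s S.· ⟦ x ⟧) (proj₂ (surj ⟦ x ⟧))) (S.inverseˡ ⟦ x ⟧)))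
    b = T.classOf y y∈K
    regroup : inv (T.point b) · y ≡ inv (section ⟦ x ⟧ · T.point b) · x
    regroup = trans (sym (assoc _ _ x)) (cong (_· x) (sym (⁻¹-anti-homo-∙ _ _)))

-- Direct products

module ProductOps {n : ℕ} (F : Fin n → FinGroup) where

  _≈ₚ_ : Prod F → Prod F → Set
  x ≈ₚ y = ∀ i → x i ≡ y i

  _·ₚ_ : Prod F → Prod F → Prod F
  (x ·ₚ y) i = FinGroup._·_ (F i) (x i) (y i)

  eₚ : Prod F
  eₚ i = FinGroup.e (F i)

  invₚ : Prod F → Prod F
  invₚ x i = FinGroup.inv (F i) (x i)

record ProdHom {n : ℕ} (F : Fin n → FinGroup) (S : FinGroup) : Set where
  open ProductOps F
  field
    ⟦_⟧  : Prod F → Elt S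
    resp : ∀ {x y} → x ≈ₚ y → ⟦ x ⟧ ≡ ⟦ y ⟧
    homo : ∀ x y → ⟦ x ·ₚ y ⟧ ≡ FinGroup._·_ S ⟦ x ⟧ ⟦ y ⟧

  private module S = Laws S

  ε-homo : ⟦ eₚ ⟧ ≡ S.e
  ε-homo = S.idempotent⇒e _ (trans (sym (homo eₚ eₚ)) (resp λ i → Laws.identityˡ (F i) _))

  ⁻¹-homo : ∀ x → ⟦ invₚ x ⟧ ≡ S.inv ⟦ x ⟧
  ⁻¹-homo x = S.inverseʳ-unique ⟦ x ⟧ ⟦ invₚ x ⟧
    (trans (sym (homo x (invₚ x))) (trans (resp λ i → Laws.inverseʳ (F i) (x i)) ε-homo))

module Cons {n : ℕ} (F : Fin (suc n) → FinGroup) where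

  _∷ₚ_ : Elt (F zero) → Prod (F ∘ suc) → Prod F
  (g ∷ₚ y) zero = g
  (g ∷ₚ y) (suc i) = y i

axis : ∀ {n} (F : Fin n → FinGroup) (j : Fin n) → Elt (F j) → Prod F
axis F zero g zero = g
axis F zero g (suc i) = FinGroup.e (F (suc i))
axis F (suc j) g zero = FinGroup.e (F zero)
axis F (suc j) g (suc i) = axis (F ∘ suc) j g i

axis-homo : ∀ {n} (F : Fin n → FinGroup) j g h → let open ProductOps F in
            axis F j (FinGroup._·_ (F j) g h) ≈ₚ (axis F j g ·ₚ axis F j h)
axis-homo F zero g h zero = refl
axis-homo F zero g h (suc i) = sym (Laws.identityˡ (F (suc i)) _)
axis-homo F (suc j) g h zero = sym (Laws.identityˡ (F zero) _)
axis-homo F (suc j) g h (suc i) = axis-homo (F ∘ suc) j g h i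

axis-conj : ∀ {n} (F : Fin n → FinGroup) j g (y : Prod F) → let open ProductOps F; open FinGroup (F j) in
            axis F j ((y j · g) · inv (y j)) ≈ₚ ((y ·ₚ axis F j g) ·ₚ invₚ y)
axis-conj F zero g y zero = refl
axis-conj F zero g y (suc i) = sym (Laws.conj-e (F (suc i)) (y (suc i)))
axis-conj F (suc j) g y zero = sym (Laws.conj-e (F zero) (y zero))
axis-conj F (suc j) g y (suc i) = axis-conj (F ∘ suc) j g (y ∘ suc) i

axisHom : ∀ {n} {F : Fin n → FinGroup} {S} → ProdHom F S → (j : Fin n) → Hom (F j) S
axisHom {F = F} χ j = record
  { ⟦_⟧ = λ g → ⟦ axis F j g ⟧
  ; homo = λ g h → trans (resp (axis-homo F j g h)) (homo _ _) }
  where open ProdHom χ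

axes-trivial⇒trivial : ∀ {n} {F : Fin n → FinGroup} {S} (χ : ProdHom F S)
  → (∀ j g → ProdHom.⟦ χ ⟧ (axis F j g) ≡ FinGroup.e S) → ∀ y → ProdHom.⟦ χ ⟧ y ≡ FinGroup.e S
axes-trivial⇒trivial {zero} {S = S} χ _ y =
  Laws.idempotent⇒e S _ (trans (sym (ProdHom.homo χ y y)) (ProdHom.resp χ λ ()))
axes-trivial⇒trivial {suc m} {F} {S} χ axes-trivial y = begin
  ⟦ y ⟧                                ≡⟨ resp split ⟩
  ⟦ axis F zero (y zero) ·ₚ y₀ ⟧       ≡⟨ homo _ _ ⟩
  ⟦ axis F zero (y zero) ⟧ · ⟦ y₀ ⟧    ≡⟨ cong₂ _·_ (axes-trivial zero (y zero)) (axes-trivial⇒trivial χ₀ axes-trivial₀ (y ∘ suc)) ⟩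
  e · e                                ≡⟨ identityˡ e ⟩
  e                                    ∎
  where
  open ProductOps F
  open Cons F
  open ProdHom χ
  open Laws S
  open ≡-Reasoning

  e₀ : Elt (F zero)
  e₀ = FinGroup.e (F zero)

  y₀ : Prod F
  y₀ = e₀ ∷ₚ (y ∘ suc)

  split : y ≈ₚ (axis F zero (y zero) ·ₚ y₀)
  split zero = sym (Laws.identityʳ (F zero) (y zero))
  split (suc i) = sym (Laws.identityˡ (F (suc i)) (y (suc i)))

  χ₀ : ProdHom (F ∘ suc) S
  χ₀ = record
    { ⟦_⟧ = λ z → ⟦ e₀ ∷ₚ z ⟧
    ; resp = λ z≈z′ → resp λ { zero → refl ; (suc i) → z≈z′ i }
    ; homo = λ z z′ → trans (resp λ { zero → sym (Laws.identityˡ (F zero) e₀) ; (suc i) → refl }) (homo _ _) }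

  axes-trivial₀ : ∀ j g → ProdHom.⟦ χ₀ ⟧ (axis (F ∘ suc) j g) ≡ e
  axes-trivial₀ j g = trans (resp λ { zero → refl ; (suc i) → refl }) (axes-trivial (suc j) g)

-- Each axis has normal image in S, since conjugating the axis by elements of the product
-- stays inside the axis; so by simplicity every non-surjective axis is killed by χ.
surjectiveAxis : ∀ {n} {F : Fin n → FinGroup} {S} (χ : ProdHom F S)
  → (∀ s → ∃[ y ] ProdHom.⟦ χ ⟧ y ≡ s) → IsSimple S → Nontrivial S → ∃[ j ] Surjective (axisHom χ j)
surjectiveAxis {n} {F} {S} χ χ-surjective simple (s , s≢e)
  with any? (λ j → all? λ t → any? λ g → ProdHom.⟦ χ ⟧ (axis F j g) ≟ t)
... | yes surjectiveOne = surjectiveOne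
... | no noneSurjective = ⊥-elim (s≢e (trans (sym ⟦y⟧≡s) (axes-trivial⇒trivial χ axis-trivial y)))
  where
  open ProductOps F
  open ProdHom χ
  open Laws S
  y = proj₁ (χ-surjective s)
  ⟦y⟧≡s = proj₂ (χ-surjective s)

  module _ (j : Fin n) where
    private
      φ = axisHom χ j
      module Fj = FinGroup (F j)

    axisImage-normal : IsNormalSubgroup S (image φ (whole (F j)))
    axisImage-normal = image-subgroup φ (whole-subgroup (F j)) , λ t u u∈ → conj (χ-surjective t) (image-elim φ u∈)
      where
      conj : ∀ {t u} → ∃[ z ] ⟦ z ⟧ ≡ t → ∃[ g ] (true ≡ true × ⟦ axis F j g ⟧ ≡ u)
           → image φ (whole (F j)) ((t · u) · inv t) ≡ true
      conj (z , refl) (g , _ , refl) = image-intro φ refl (begin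
        ⟦ axis F j ((z j Fj.· g) Fj.· Fj.inv (z j)) ⟧   ≡⟨ resp (axis-conj F j g z) ⟩
        ⟦ (z ·ₚ axis F j g) ·ₚ invₚ z ⟧                 ≡⟨ homo _ _ ⟩
        ⟦ z ·ₚ axis F j g ⟧ · ⟦ invₚ z ⟧                ≡⟨ cong₂ _·_ (homo z _) (ProdHom.⁻¹-homo χ z) ⟩
        (⟦ z ⟧ · ⟦ axis F j g ⟧) · inv ⟦ z ⟧            ∎)
        where open ≡-Reasoning

    axis-trivial : ∀ g → ⟦ axis F j g ⟧ ≡ e
    axis-trivial g with simple _ axisImage-normal
    ... | inj₁ image-trivial = image-trivial _ (image-intro φ refl refl)
    ... | inj₂ image-whole = ⊥-elim (noneSurjective (j , λ t → onto (image-elim φ (image-whole t))))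
      where
      onto : ∀ {t} → ∃[ g ] (true ≡ true × ⟦ axis F j g ⟧ ≡ t) → ∃[ g ] ⟦ axis F j g ⟧ ≡ t
      onto (g , _ , eq) = g , eq

-- Subdirect products

≡1⇒allEqual : ∀ {m} → m ≡ 1 → (i j : Fin m) → i ≡ j
≡1⇒allEqual refl zero zero = refl

record CommonSimpleQuotient (A B : FinGroup) : Set where
  field
    S            : FinGroup
    simple       : IsSimple S
    nontrivial   : Nontrivial S
    φ            : Hom A S
    φ-surjective : Surjective φ
    ψ            : Hom B S
    ψ-surjective : Surjective ψ

module _ {A B : FinGroup} (Q : CommonSimpleQuotient A B) where
  open CommonSimpleQuotient Q
  open FinGroup S

  abelian⇒¬coprime : (∀ a b → a · b ≡ b · a)
    → ¬ (∀ a b → AbelianizationOrder A a → AbelianizationOrder B b → Coprime a b)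
  abelian⇒¬coprime commutative coprime = s≢e (≡1⇒allEqual |S|≡1 s e)
    where
    A-ab = surjection⇒abelianizationOrder φ φ-surjective commutative
    B-ab = surjection⇒abelianizationOrder ψ ψ-surjective commutative
    |S|≡1 = coprime _ _ (proj₂ A-ab) (proj₂ B-ab) (m∣m*n (proj₁ A-ab) , m∣m*n (proj₁ B-ab))
    s = proj₁ nontrivial
    s≢e = proj₂ nontrivial

  nonabelian⇒¬disjoint : NonAbelianSimple S
    → ¬ (∀ T → NonAbelianSimple T → OccursAsFactor A T → OccursAsFactor B T → ⊥)
  nonabelian⇒¬disjoint S-nonabelian disjoint = disjoint S S-nonabelian
    (surjection⇒occurs φ φ-surjective simple nontrivial) (surjection⇒occurs ψ ψ-surjective simple nontrivial)

  commonSimpleQuotient⇒⊥ : (∀ T → NonAbelianSimple T → OccursAsFactor A T → OccursAsFactor B T → ⊥)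
    → (∀ a b → AbelianizationOrder A a → AbelianizationOrder B b → Coprime a b) → ⊥
  commonSimpleQuotient⇒⊥ disjoint coprime with all? (λ a → all? λ b → (a · b) ≟ (b · a))
  ... | yes commutative = abelian⇒¬coprime commutative coprime
  ... | no noncommutative =
    let (a , a-noncentral) = ¬∀⟶∃¬ _ _ (λ a → all? λ b → (a · b) ≟ (b · a)) noncommutative
        (b , ab≢ba) = ¬∀⟶∃¬ _ _ (λ b → (a · b) ≟ (b · a)) a-noncentral
    in nonabelian⇒¬disjoint ((a , b , ab≢ba) , simple) disjoint

module InductionStep {m : ℕ} (G : Fin (suc m) → FinGroup) {H : Prod G → Bool} (H-subgroup : IsSubgroupOfProd G H)
            (H-onto : ∀ i (g : Elt (G i)) → ∃[ x ] (H x ≡ true × x i ≡ g)) where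
  open ProductOps G
  open Cons G
  private
    module G₀ = Laws (G zero)
    module G₊ = ProductOps (G ∘ suc)
    H-resp = proj₁ H-subgroup
    e∈H = proj₁ (proj₂ H-subgroup)
    ·-closed = proj₁ (proj₂ (proj₂ H-subgroup))
    inv-closed = proj₂ (proj₂ (proj₂ H-subgroup))

    H-split : ∀ {x} → H x ≡ true → H (x zero ∷ₚ (x ∘ suc)) ≡ true
    H-split = H-resp _ _ λ { zero → refl ; (suc i) → refl }

  H₊ : Prod (G ∘ suc) → Bool
  H₊ y = does (any? λ g → H (g ∷ₚ y) Bool.≟ true)

  H₊-intro : ∀ {g y} → H (g ∷ₚ y) ≡ true → H₊ y ≡ true
  H₊-intro {g} H∋ = dec-true (any? _) (g , H∋)

  H₊-elim : ∀ {y} → H₊ y ≡ true → ∃[ g ] H (g ∷ₚ y) ≡ true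
  H₊-elim = from-does (any? _)

  H₊-subgroup : IsSubgroupOfProd (G ∘ suc) H₊
  H₊-subgroup =
      (λ y y′ y≈y′ y∈ → let (g , H∋) = H₊-elim y∈ in H₊-intro (H-resp _ _ (λ { zero → refl ; (suc i) → y≈y′ i }) H∋))
    , H₊-intro (H-resp _ _ (λ { zero → refl ; (suc i) → refl }) e∈H)
    , (λ y y′ y∈ y′∈ → let (g , H∋) = H₊-elim y∈ ; (g′ , H∋′) = H₊-elim y′∈
                       in H₊-intro (H-resp _ _ (λ { zero → refl ; (suc i) → refl }) (·-closed _ _ H∋ H∋′)))
    , (λ y y∈ → let (g , H∋) = H₊-elim y∈ in H₊-intro (H-resp _ _ (λ { zero → refl ; (suc i) → refl }) (inv-closed _ H∋)))

  H₊-onto : ∀ i (g : Elt (G (suc i))) → ∃[ y ] (H₊ y ≡ true × y i ≡ g)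
  H₊-onto i g = let (x , x∈H , xi≡g) = H-onto (suc i) g in x ∘ suc , H₊-intro (H-split x∈H) , xi≡g

  module _ (H₊-whole : ∀ y → H₊ y ≡ true) where

    K : SubsetG (G zero)
    K g = H (g ∷ₚ G₊.eₚ)

    K-normal : IsNormalSubgroup (G zero) K
    K-normal =
        ( H-resp _ _ (λ { zero → refl ; (suc i) → refl }) e∈H
        , (λ g h g∈ h∈ → H-resp _ _ (λ { zero → refl ; (suc i) → Laws.identityˡ (G (suc i)) _ }) (·-closed _ _ g∈ h∈))
        , (λ g g∈ → H-resp _ _ (λ { zero → refl ; (suc i) → Laws.ε⁻¹≈ε (G (suc i)) }) (inv-closed _ g∈)) )
      , λ g h h∈ → conj (H-onto zero g) h∈
      where
      conj : ∀ {g h} → ∃[ x ] (H x ≡ true × x zero ≡ g) → K h ≡ true → K ((g G₀.· h) G₀.· G₀.inv g) ≡ true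
      conj (x , x∈H , refl) h∈ =
        H-resp _ _ (λ { zero → refl ; (suc i) → Laws.conj-e (G (suc i)) (x (suc i)) })
          (·-closed _ _ (·-closed _ _ x∈H h∈) (inv-closed _ x∈H))

    K-whole⇒H-whole : whole (G zero) ⊆ᵇ K → ∀ x → H x ≡ true
    K-whole⇒H-whole K-whole x =
      let (g , H∋) = H₊-elim (H₊-whole (x ∘ suc))
      in H-resp _ _ (λ { zero → G₀.\\-leftDividesˡ g (x zero) ; (suc i) → Laws.identityʳ (G (suc i)) (x (suc i)) })
           (·-closed _ _ H∋ (K-whole (G₀.inv g G₀.· x zero) refl))

    module _ {B : SubsetG (G zero)} (B-normal : IsNormalSubgroup (G zero) B) (K⊆B : K ⊆ᵇ B) where
      open Quotient (G zero) B-normal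

      first : Prod (G ∘ suc) → Elt (G zero)
      first y = proj₁ (H₊-elim (H₊-whole y))

      first∈H : ∀ y → H (first y ∷ₚ y) ≡ true
      first∈H y = proj₂ (H₊-elim (H₊-whole y))

      -- Two elements of H with the same tail differ by an element of K ⊆ B in the first coordinate.
      π-first : ∀ {g y} → H (g ∷ₚ y) ≡ true → π⟦ first y ⟧ ≡ π⟦ g ⟧
      π-first {g} {y} g∷y∈H = π-cong (K⊆B _ (H-resp _ _ (λ { zero → refl ; (suc i) → Laws.inverseˡ (G (suc i)) (y i) })
                                               (·-closed _ _ (inv-closed _ (first∈H y)) g∷y∈H)))

      ψ : ProdHom (G ∘ suc) G/N
      ψ = record
        { ⟦_⟧ = λ y → π⟦ first y ⟧
        ; resp = λ {y} y≈y′ → sym (π-first (H-resp _ _ (λ { zero → refl ; (suc i) → y≈y′ i }) (first∈H y)))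
        ; homo = λ y y′ → trans (π-first (H-resp _ _ (λ { zero → refl ; (suc i) → refl })
                                                     (·-closed _ _ (first∈H y) (first∈H y′))))
                                (π-homo _ _)
        }

      ψ-surjective : ∀ s → ∃[ y ] ProdHom.⟦ ψ ⟧ y ≡ s
      ψ-surjective s =
        let (g , πg≡s) = π-surjective s ; (x , x∈H , x₀≡g) = H-onto zero g
        in x ∘ suc , trans (π-first (H-split x∈H)) (trans (cong π⟦_⟧ x₀≡g) πg≡s)

    K-proper⇒commonSimpleQuotient : ¬ whole (G zero) ⊆ᵇ K → ∃[ j ] CommonSimpleQuotient (G zero) (G (suc j))
    K-proper⇒commonSimpleQuotient K-proper =
      let (B , K⊆B , B-maximal) = maximalNormalAbove (G zero) K-properNormal
          open MaximalNormalIn B-maximal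
          B-normal = subgroup , λ g x → normal g x refl
          open Quotient (G zero) B-normal
          simple = kernel-maximal⇒simple π π-surjective π-kernel maximal
          (x , _ , x∉B) = proper
          nontrivial = π⟦ x ⟧ , x∉B ∘ Equivalence.to (π-kernel x)
          (j , axis-surjective) = surjectiveAxis (ψ B-normal K⊆B) (ψ-surjective B-normal K⊆B) simple nontrivial
      in j , record { S = G/N ; simple = simple ; nontrivial = nontrivial
                    ; φ = π ; φ-surjective = π-surjective
                    ; ψ = axisHom (ψ B-normal K⊆B) j ; ψ-surjective = axis-surjective }
      where
      K-properNormal : ProperNormalIn (G zero) (whole (G zero)) K
      K-properNormal = record
        { subgroup = proj₁ K-normal ; ⊆X = λ _ _ → refl ; normal = λ g x _ → proj₂ K-normal g x
        ; proper = ⊈⇒∃ K-proper }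

    H-whole : (∀ i j → i ≢ j → ∀ S → NonAbelianSimple S → OccursAsFactor (G i) S → OccursAsFactor (G j) S → ⊥)
            → (∀ i j → i ≢ j → ∀ a b → AbelianizationOrder (G i) a → AbelianizationOrder (G j) b → Coprime a b)
            → ∀ x → H x ≡ true
    H-whole disjoint coprime with whole (G zero) ⊆ᵇ? K
    ... | yes K-whole = K-whole⇒H-whole K-whole
    ... | no K-proper =
      let (j , Q) = K-proper⇒commonSimpleQuotient K-proper
      in ⊥-elim (commonSimpleQuotient⇒⊥ Q (disjoint zero (suc j) λ ()) (coprime zero (suc j) λ ()))

lemmaA4 : (n : ℕ) (G : Fin n → FinGroup)
    → (∀ i j → i ≢ j → ∀ S → NonAbelianSimple S
         → OccursAsFactor (G i) S → OccursAsFactor (G j) S → ⊥)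
    → (∀ i j → i ≢ j → ∀ a b
         → AbelianizationOrder (G i) a → AbelianizationOrder (G j) b → Coprime a b)
    → (H : Prod G → Bool) → IsSubgroupOfProd G H
    → (∀ i (g : Fin (FinGroup.order (G i))) → ∃[ x ] (H x ≡ true × x i ≡ g))
    → ∀ x → H x ≡ true
lemmaA4 zero G _ _ H H-subgroup _ x = proj₁ H-subgroup _ x (λ ()) (proj₁ (proj₂ H-subgroup))
lemmaA4 (suc m) G disjoint coprime H H-subgroup H-onto =
  H-whole (lemmaA4 m (G ∘ suc) (λ i j i≢j → disjoint (suc i) (suc j) (i≢j ∘ suc-injective))
                               (λ i j i≢j → coprime (suc i) (suc j) (i≢j ∘ suc-injective))
                               H₊ H₊-subgroup H₊-onto)
          disjoint coprime
  where open InductionStep G H-subgroup H-onto
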